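{- Let $k,\ell\in\mathbb{N}$ with $k-2\ge\ell\ge1$. Then $x\mapsto x+2F_{k-2}$ is a bijection from $\overline{\mathcal{V}}_\ell\cap[F_\ell,F_{k-1}+F_{k-3}]$ onto $\overline{\mathcal{V}}_\ell\cap[F_\ell+2F_{k-2},F_{k+1}]$.
   Context: Fibonacci numbers: $F_{ -1}=0$, $F_0=1$, $F_{i+2}=F_{i+1}+F_i$; $\overline{\mathcal{F}}=\{F_i: i\ge-1\}$. Define $\bar\iota:\mathbb{N}\to\mathbb{N}$ by $\bar\iota(x)=x$ if $x\in\overline{\mathcal{F}}$, and $\bar\iota(x)=x-2F_{i-2}$ if $F_i<x<F_{i+1}$ for an integer $i\ge3$. Define $\bar\alpha(x)=\lim_{k\to\infty}\bar\iota^k(x)$. For $\ell\ge1$, $\overline{\mathcal{V}}_\ell=\{x\in\mathbb{N}: \bar\alpha(x)\ge F_\ell\}$. -}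

module Defs where

open import Data.Nat using (ℕ; zero; suc; _+_; _*_; _∸_; _≤_; _<_)
open import Data.Product using (Σ; ∃; _×_)
open import Data.Sum using (_⊎_)
open import Relation.Binary.PropositionalEquality using (_≡_)

-- Fibonacci numbers with the paper's indexing: F 0 = F_0 = 1, F 1 = F_1 = 1,
-- F (i+2) = F (i+1) + F i.  The extra value F_{-1} = 0 is handled in 𝓕̄ below.
F : ℕ → ℕ
F zero = 1
F (suc zero) = 1
F (suc (suc n)) = F (suc n) + F n

-- membership in 𝓕̄ = { F_i : i ≥ -1 } = {0} ∪ { F i : i ≥ 0 }
InFbar : ℕ → Set
InFbar x = (x ≡ 0) ⊎ (∃ λ i → F i ≡ x)

-- the map ῑ, written as its graph:  ι̅ x y  means  ῑ(x) = y.
--   ῑ(x) = x                 if x ∈ 𝓕̄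
--   ῑ(x) = x - 2 F_{i-2}     if F_i < x < F_{i+1}, i ≥ 3
data ι̅ : ℕ → ℕ → Set where
  fixed : ∀ {x} → InFbar x → ι̅ x x
  shift : ∀ {x i} → 3 ≤ i → F i < x → x < F (suc i) →
          ι̅ x (x ∸ 2 * F (i ∸ 2))

data ι̅Iter : ℕ → ℕ → ℕ → Set where
  iter-zero : ∀ {x} → ι̅Iter zero x x
  iter-suc  : ∀ {k x y z} → ι̅ x y → ι̅Iter k y z → ι̅Iter (suc k) x z

-- ᾱ(x) = y, i.e. lim_{k→∞} ῑ^k(x) = y in the discrete space ℕ
-- (the sequence is eventually equal to y)
ᾱ≡ : ℕ → ℕ → Set
ᾱ≡ x y = ∃ λ N → ∀ k → N ≤ k → ι̅Iter k x y

Vbar : ℕ → ℕ → Set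
Vbar ℓ x = ∃ λ y → ᾱ≡ x y × F ℓ ≤ y

-- Write b = F (1+n) and T = F (2+n) + F n, so that F (3+n) = F n + 2b and
-- F (4+n) = T + 2b.  On the open interval (F (3+n), F (4+n)) the map ῑ is
-- y ↦ y − 2b, and ᾱ is constant along ῑ-orbits, so x and x + 2b have the same ᾱ
-- when F n < x < T.  For x < F n, one step of ῑ takes x + 2b to x + 2 F (n−1),
-- which reduces the claim to n − 2.  At x = F n both x and x + 2b = F (3+n) are
-- Fibonacci numbers; at x = T the image T + 2b = F (4+n) is one, and
-- ῑ(T) = F (1+n) ≥ F ℓ (for n ≥ 1; T = F 3 for n = 0).
module Submission where

open import Defs
open import Data.Nat using (ℕ; zero; suc; _+_; _*_; _∸_; _≤_; _<_; z≤n; s≤s; s≤s⁻¹)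
open import Data.Nat.Properties
open import Data.Nat.Tactic.RingSolver using (solve-∀)
open import Data.Product using (∃; _×_; _,_; map₁; map₂)
open import Data.Sum using (inj₁; inj₂)
open import Data.Empty using (⊥; ⊥-elim)
open import Function.Bundles using (_⇔_; mk⇔; Equivalence)
import Function.Properties.Equivalence as ⇔
open import Relation.Binary.Definitions using (tri<; tri≈; tri>)
open import Relation.Binary.PropositionalEquality

open Equivalence using (to; from)

∸-interval : ∀ {a b c y} → a + c ≤ y → y ≤ b + c → a ≤ y ∸ c × y ∸ c ≤ b × y ∸ c + c ≡ y
∸-interval {a} {b} {c} {y} a+c≤y y≤b+c =
  m+n≤o⇒m≤o∸n a a+c≤y ,
  m≤n+o⇒m∸n≤o y c (subst (y ≤_) (+-comm b c) y≤b+c) ,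
  m∸n+n≡m (≤-trans (m≤n+m c a) a+c≤y)

F-pos : ∀ n → 1 ≤ F n
F-pos zero = s≤s z≤n
F-pos (suc zero) = s≤s z≤n
F-pos (suc (suc n)) = ≤-trans (F-pos (suc n)) (m≤m+n _ _)

F-≤-suc : ∀ n → F n ≤ F (suc n)
F-≤-suc zero = ≤-refl
F-≤-suc (suc n) = m≤m+n _ _

F-mono-≤ : ∀ {m n} → m ≤ n → F m ≤ F n
F-mono-≤ {m} {n} m≤n with m≤n⇒m<n∨m≡n m≤n
... | inj₂ refl = ≤-refl
F-mono-≤ {m} {suc n} _ | inj₁ (s≤s m≤n) = ≤-trans (F-mono-≤ m≤n) (F-≤-suc n)

F-cancel-< : ∀ {m n} → F m < F n → m < n
F-cancel-< Fm<Fn = ≰⇒> (λ n≤m → <⇒≱ Fm<Fn (F-mono-≤ n≤m))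

F-+3 : ∀ n → F (3 + n) ≡ F n + 2 * F (1 + n)
F-+3 n = identity (F n) (F (1 + n))
  where
  identity : ∀ a b → (b + a) + b ≡ a + 2 * b
  identity = solve-∀

F-+4 : ∀ n → F (4 + n) ≡ (F (2 + n) + F n) + 2 * F (1 + n)
F-+4 n = identity (F n) (F (1 + n))
  where
  identity : ∀ a b → ((b + a) + b) + (b + a) ≡ ((b + a) + a) + 2 * b
  identity = solve-∀

F-not-between : ∀ {i j} → F i < F j → F j < F (suc i) → ⊥
F-not-between {i} {j} Fi<Fj Fj<Fi+1 =
  <⇒≱ (F-cancel-< {i} {j} Fi<Fj) (s≤s⁻¹ (F-cancel-< {j} {suc i} Fj<Fi+1))

F-interval-unique : ∀ {i j x} → F i < x → x < F (suc i) → F j < x → x < F (suc j) → i ≡ j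
F-interval-unique {i} {j} Fi<x x<Fi+1 Fj<x x<Fj+1 =
  ≤-antisym (s≤s⁻¹ (F-cancel-< {i} {suc j} (<-trans Fi<x x<Fj+1)))
            (s≤s⁻¹ (F-cancel-< {j} {suc i} (<-trans Fj<x x<Fi+1)))

ι̅-functional : ∀ {x y z} → ι̅ x y → ι̅ x z → y ≡ z
ι̅-functional (fixed _) (fixed _) = refl
ι̅-functional (fixed (inj₁ refl)) (shift _ () _)
ι̅-functional (fixed (inj₂ (j , refl))) (shift {i = i} _ Fi<x x<Fi+1) =
  ⊥-elim (F-not-between {i} {j} Fi<x x<Fi+1)
ι̅-functional (shift _ () _) (fixed (inj₁ refl))
ι̅-functional (shift {i = i} _ Fi<x x<Fi+1) (fixed (inj₂ (j , refl))) =
  ⊥-elim (F-not-between {i} {j} Fi<x x<Fi+1)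
ι̅-functional {x} (shift {i = i} _ Fi<x x<Fi+1) (shift {i = j} _ Fj<x x<Fj+1) =
  cong (λ i → x ∸ 2 * F (i ∸ 2)) (F-interval-unique {i} {j} Fi<x x<Fi+1 Fj<x x<Fj+1)

ι̅Iter-fixed : ∀ {x} → InFbar x → ∀ k → ι̅Iter k x x
ι̅Iter-fixed x∈𝓕̄ zero = iter-zero
ι̅Iter-fixed x∈𝓕̄ (suc k) = iter-suc (fixed x∈𝓕̄) (ι̅Iter-fixed x∈𝓕̄ k)

ᾱ≡-fixed : ∀ {x} → InFbar x → ᾱ≡ x x
ᾱ≡-fixed x∈𝓕̄ = 0 , λ k _ → ι̅Iter-fixed x∈𝓕̄ k

ᾱ≡-ι̅ : ∀ {x y z} → ι̅ x y → ᾱ≡ x z ⇔ ᾱ≡ y z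
ᾱ≡-ι̅ {x} {y} {z} x↦y = mk⇔ forward backward
  where
  forward : ᾱ≡ x z → ᾱ≡ y z
  forward (N , iterates) = N , λ k N≤k → tail (iterates (suc k) (m≤n⇒m≤1+n N≤k))
    where
    tail : ∀ {k} → ι̅Iter (suc k) x z → ι̅Iter k y z
    tail (iter-suc x↦y′ rest) = subst (λ w → ι̅Iter _ w z) (ι̅-functional x↦y′ x↦y) rest

  backward : ᾱ≡ y z → ᾱ≡ x z
  backward (N , iterates) = suc N , λ where (suc k) (s≤s N≤k) → iter-suc x↦y (iterates k N≤k)

Vbar-ι̅ : ∀ ℓ {x y} → ι̅ x y → Vbar ℓ x ⇔ Vbar ℓ y
Vbar-ι̅ _ x↦y = mk⇔ (map₂ (map₁ (to (ᾱ≡-ι̅ x↦y)))) (map₂ (map₁ (from (ᾱ≡-ι̅ x↦y))))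

Vbar-fixed : ∀ ℓ {x} → InFbar x → F ℓ ≤ x → Vbar ℓ x
Vbar-fixed _ {x} x∈𝓕̄ Fℓ≤x = x , ᾱ≡-fixed x∈𝓕̄ , Fℓ≤x

ι̅-shift-down : ∀ i {x} → F i < x → x < F (2 + i) + F i → ι̅ (x + 2 * F (1 + i)) x
ι̅-shift-down i {x} Fi<x x<T =
  subst (ι̅ (x + 2 * F (1 + i))) (m+n∸n≡m x (2 * F (1 + i)))
    (shift {i = 3 + i} (s≤s (s≤s (s≤s z≤n))) lower upper)
  where
  lower : F (3 + i) < x + 2 * F (1 + i)
  lower = subst (_< x + 2 * F (1 + i)) (sym (F-+3 i)) (+-monoˡ-< (2 * F (1 + i)) Fi<x)

  upper : x + 2 * F (1 + i) < F (4 + i)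
  upper = subst (x + 2 * F (1 + i) <_) (sym (F-+4 i)) (+-monoˡ-< (2 * F (1 + i)) x<T)

Vbar-shift-< : ∀ n ℓ {x} → F ℓ ≤ x → x < F (2 + n) + F n →
               Vbar ℓ x ⇔ Vbar ℓ (x + 2 * F (1 + n))
Vbar-shift-< n ℓ {x} Fℓ≤x x<T with <-cmp x (F n)
... | tri> _ _ Fn<x = ⇔.sym (Vbar-ι̅ ℓ (ι̅-shift-down n Fn<x x<T))
... | tri≈ _ refl _ =
  mk⇔ (λ _ → Vbar-fixed ℓ (inj₂ (3 + n , F-+3 n)) (≤-trans Fℓ≤x (m≤m+n _ _)))
      (λ _ → Vbar-fixed ℓ (inj₂ (n , refl)) Fℓ≤x)
Vbar-shift-< zero ℓ Fℓ≤x _ | tri< x<1 _ _ = ⊥-elim (<⇒≱ x<1 (≤-trans (F-pos ℓ) Fℓ≤x))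
Vbar-shift-< (suc zero) ℓ Fℓ≤x _ | tri< x<1 _ _ = ⊥-elim (<⇒≱ x<1 (≤-trans (F-pos ℓ) Fℓ≤x))
Vbar-shift-< (suc (suc m)) ℓ {x} Fℓ≤x _ | tri< x<a _ _ =
  subst (λ y → Vbar ℓ x ⇔ Vbar ℓ y) (regroup x a c)
    (⇔.trans (Vbar-shift-< m ℓ Fℓ≤x (<-≤-trans x<a (m≤m+n _ _))) (⇔.sym (Vbar-ι̅ ℓ step)))
  where
  a = F (2 + m)
  c = F (1 + m)

  regroup : ∀ x a c → (x + 2 * c) + 2 * a ≡ x + 2 * (a + c)
  regroup = solve-∀

  lower : c < x + 2 * c
  lower = <-≤-trans (m<n+m c (≤-trans (F-pos ℓ) Fℓ≤x)) (+-monoʳ-≤ x (m≤m+n c (c + 0)))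

  upper : x + 2 * c < (a + c) + c
  upper = subst (x + 2 * c <_) (unfold-double a c) (+-monoˡ-< (2 * c) x<a)
    where
    unfold-double : ∀ a c → a + 2 * c ≡ (a + c) + c
    unfold-double = solve-∀

  step : ι̅ ((x + 2 * c) + 2 * a) (x + 2 * c)
  step = ι̅-shift-down (1 + m) lower upper

Vbar-Lucas : ∀ n {ℓ} → ℓ ≤ 1 + n → F ℓ ≤ F (2 + n) + F n → Vbar ℓ (F (2 + n) + F n)
Vbar-Lucas zero {ℓ} _ Fℓ≤3 = Vbar-fixed ℓ (inj₂ (3 , refl)) Fℓ≤3
Vbar-Lucas (suc m) {ℓ} ℓ≤2+m _ =
  from (Vbar-ι̅ ℓ step) (Vbar-fixed ℓ (inj₂ (2 + m , refl)) (F-mono-≤ ℓ≤2+m))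
  where
  regroup : ∀ a b → (b + a) + 2 * b ≡ ((b + a) + b) + b
  regroup = solve-∀

  step : ι̅ (F (3 + m) + F (1 + m)) (F (2 + m))
  step = subst (λ y → ι̅ y (F (2 + m))) (regroup (F m) (F (1 + m)))
           (ι̅-shift-down m (m<n+m (F m) (F-pos (1 + m))) (m<m+n (F (2 + m)) (F-pos m)))

Vbar-shift : ∀ n {ℓ x} → ℓ ≤ 1 + n → F ℓ ≤ x → x ≤ F (2 + n) + F n →
             Vbar ℓ x ⇔ Vbar ℓ (x + 2 * F (1 + n))
Vbar-shift n {ℓ} ℓ≤1+n Fℓ≤x x≤T with m≤n⇒m<n∨m≡n x≤T
... | inj₁ x<T = Vbar-shift-< n ℓ Fℓ≤x x<T
... | inj₂ refl =
  mk⇔ (λ _ → Vbar-fixed ℓ (inj₂ (4 + n , F-+4 n)) (≤-trans Fℓ≤x (m≤m+n _ _)))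
      (λ _ → Vbar-Lucas n ℓ≤1+n Fℓ≤x)

proposition4p6 : (k ℓ : ℕ) → 1 ≤ ℓ → ℓ + 2 ≤ k →
    -- maps  𝒱̄_ℓ ∩ [F_ℓ, F_{k-1}+F_{k-3}]  into  𝒱̄_ℓ ∩ [F_ℓ+2F_{k-2}, F_{k+1}]
    ((x : ℕ) → Vbar ℓ x → F ℓ ≤ x → x ≤ F (k ∸ 1) + F (k ∸ 3) →
      Vbar ℓ (x + 2 * F (k ∸ 2)) × F ℓ + 2 * F (k ∸ 2) ≤ x + 2 * F (k ∸ 2)
        × x + 2 * F (k ∸ 2) ≤ F (k + 1))
    -- injective on the domain
    × ((x x′ : ℕ) → x + 2 * F (k ∸ 2) ≡ x′ + 2 * F (k ∸ 2) → x ≡ x′)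
    -- surjective onto the target
    × ((y : ℕ) → Vbar ℓ y → F ℓ + 2 * F (k ∸ 2) ≤ y → y ≤ F (k + 1) →
      ∃ λ x → (Vbar ℓ x × F ℓ ≤ x × x ≤ F (k ∸ 1) + F (k ∸ 3))
        × x + 2 * F (k ∸ 2) ≡ y)
proposition4p6 k ℓ 1≤ℓ ℓ+2≤k with ≤-trans (+-monoˡ-≤ 2 1≤ℓ) ℓ+2≤k
... | s≤s (s≤s (s≤s {n = n} _)) = into , +-cancelʳ-≡ 2b , onto
  where
  2b = 2 * F (1 + n)
  T  = F (2 + n) + F n

  ℓ≤1+n : ℓ ≤ 1 + n
  ℓ≤1+n = +-cancelʳ-≤ 2 ℓ (1 + n) (subst (ℓ + 2 ≤_) (sym (+-comm (1 + n) 2)) ℓ+2≤k)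

  F-top : F (3 + n + 1) ≡ T + 2b
  F-top = trans (cong (λ m → F (3 + m)) (+-comm n 1)) (F-+4 n)

  into : (x : ℕ) → Vbar ℓ x → F ℓ ≤ x → x ≤ T →
         Vbar ℓ (x + 2b) × F ℓ + 2b ≤ x + 2b × x + 2b ≤ F (3 + n + 1)
  into x x∈𝒱̄ Fℓ≤x x≤T =
    to (Vbar-shift n ℓ≤1+n Fℓ≤x x≤T) x∈𝒱̄ , +-monoˡ-≤ 2b Fℓ≤x ,
    subst (x + 2b ≤_) (sym F-top) (+-monoˡ-≤ 2b x≤T)

  onto : (y : ℕ) → Vbar ℓ y → F ℓ + 2b ≤ y → y ≤ F (3 + n + 1) →
         ∃ λ x → (Vbar ℓ x × F ℓ ≤ x × x ≤ T) × x + 2b ≡ y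
  onto y y∈𝒱̄ Fℓ+2b≤y y≤top with ∸-interval Fℓ+2b≤y (subst (y ≤_) F-top y≤top)
  ... | Fℓ≤x , x≤T , x+2b≡y =
    y ∸ 2b ,
    (from (Vbar-shift n ℓ≤1+n Fℓ≤x x≤T) (subst (Vbar ℓ) (sym x+2b≡y) y∈𝒱̄) , Fℓ≤x , x≤T) ,
    x+2b≡y
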